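{- Let $P$ be a finite path and let $f:V(P)\to\{2,3\}$. Then $P$ is $(f,3,\tfrac13)$-reductive.
   Context: For $f:V(P)\to\mathbb N$, an $f$-assignment on $P$ maps each $v$ to a set $L(v)$ of exactly $f(v)$ colors; an $L$-coloring is a proper coloring $\phi$ with $\phi(v)\in L(v)$. For an integer $k\ge3$ and $0<\alpha\le1/k$, a graph $H$ is $(f,k,\alpha)$-reductive if for every $f$-assignment $L$ on $H$ there is a probability distribution on $L$-colorings $\phi$ of $H$ such that (FIX) $\Pr(\phi(v)=c)\ge\alpha$ for every $v\in V(H)$ and $c\in L(v)$; and (FORB) for every $U\subseteq V(H)$ with $|U|\le k-2$ and every color $c\in\bigcup_{u\in U}L(u)$, $\Pr(\phi(u)\ne c\ \forall u\in U)\ge\alpha$. -}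

module Defs where

open import Data.Nat as ℕ using (ℕ; suc; _∸_)
open import Data.Fin using (Fin; toℕ)
open import Data.Fin.Properties using (all?)
open import Data.Fin.Subset using (Subset; _∈_; ∣_∣)
open import Data.Fin.Subset.Properties using (_∈?_)
open import Data.List using (List; []; _∷_; length)
open import Data.List.Relation.Unary.All using (All)
open import Data.List.Relation.Unary.Unique.Propositional using (Unique)
import Data.List.Membership.Propositional as LM
open import Data.Product using (Σ; ∃; _×_; _,_; proj₁; proj₂)
open import Data.Sum using (_⊎_)
open import Data.Rational using (ℚ; 0ℚ; 1ℚ; _+_; _≤_)
open import Relation.Binary.PropositionalEquality using (_≡_; _≢_)
open import Relation.Nullary using (Dec; yes; no; ¬_)
open import Relation.Nullary.Decidable using (_→-dec_; ¬?)

Graph : ℕ → Set₁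
Graph n = Fin n → Fin n → Set

PathGraph : (n : ℕ) → Graph n
PathGraph n u v = toℕ v ≡ suc (toℕ u) ⊎ toℕ u ≡ suc (toℕ v)

ListAssignment : ℕ → Set
ListAssignment n = Fin n → List ℕ

IsFAssignment : {n : ℕ} → (Fin n → ℕ) → ListAssignment n → Set
IsFAssignment f L = ∀ v → Unique (L v) × length (L v) ≡ f v

IsLColoring : {n : ℕ} → Graph n → ListAssignment n → (Fin n → ℕ) → Set
IsLColoring G L φ = (∀ v → φ v LM.∈ L v) × (∀ u v → G u v → φ u ≢ φ v)

Dist : ℕ → Set
Dist n = List (ℚ × (Fin n → ℕ))

Pr : {n : ℕ} → (E : (Fin n → ℕ) → Set) → (∀ φ → Dec (E φ)) → Dist n → ℚ
Pr E E? [] = 0ℚ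
Pr E E? ((w , φ) ∷ D) with E? φ
... | yes _ = w + Pr E E? D
... | no  _ = Pr E E? D

totalMass : {n : ℕ} → Dist n → ℚ
totalMass [] = 0ℚ
totalMass ((w , _) ∷ D) = w + totalMass D

IsLColoringDist : {n : ℕ} → Graph n → ListAssignment n → Dist n → Set
IsLColoringDist G L D =
  All (λ p → (0ℚ ≤ proj₁ p) × IsLColoring G L (proj₂ p)) D × totalMass D ≡ 1ℚ

HasColor : {n : ℕ} → Fin n → ℕ → (Fin n → ℕ) → Set
HasColor v c φ = φ v ≡ c

hasColor? : {n : ℕ} → (v : Fin n) → (c : ℕ) → ∀ φ → Dec (HasColor v c φ)
hasColor? v c φ = φ v ℕ.≟ c

Avoids : {n : ℕ} → Subset n → ℕ → (Fin n → ℕ) → Set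
Avoids U c φ = ∀ u → u ∈ U → φ u ≢ c

avoids? : {n : ℕ} → (U : Subset n) → (c : ℕ) → ∀ φ → Dec (Avoids U c φ)
avoids? U c φ = all? (λ u → (u ∈? U) →-dec ¬? (φ u ℕ.≟ c))

Reductive : {n : ℕ} → Graph n → (Fin n → ℕ) → ℕ → ℚ → Set
Reductive {n} H f k α =
  ∀ (L : ListAssignment n) → IsFAssignment f L →
  Σ (Dist n) λ D → IsLColoringDist H L D
    × (∀ v c → c LM.∈ L v → α ≤ Pr (HasColor v c) (hasColor? v c) D)
    × (∀ (U : Subset n) → ∣ U ∣ ℕ.≤ k ∸ 2 →
         ∀ c → (∃ λ u → u ∈ U × c LM.∈ L u) →
         α ≤ Pr (Avoids U c) (avoids? U c) D)

-- Give every vertex v a column: a triple of colours of L(v) in which every colour of L(v)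
-- occurs, consecutive columns differing in each coordinate.  The three coordinates are then
-- proper L-colourings, and the uniform distribution on them satisfies (FIX) because each colour
-- of L(v) occurs in the column of v, and (FORB) because U is a single vertex and a column over
-- two distinct colours is not constant, so one coordinate avoids the forbidden colour.
-- Columns extend along the path: given a non-constant column x, rotate so that x₁ ≠ x₂, put
-- a colour other than x₀ first, and order the remaining two colours to avoid (x₁, x₂).
module Submission where

open import Defs
open import Data.Nat using (ℕ)
open import Data.Fin using (Fin)
open import Data.Sum using (_⊎_)
open import Data.Integer using (+_)
open import Data.Rational using (_/_)
open import Relation.Binary.PropositionalEquality using (_≡_)

open import Data.Nat as ℕ using (zero; suc; s≤s)
import Data.Nat.Properties as ℕ
open import Data.Fin as Fin using (toℕ) renaming (zero to fzero; suc to fsuc)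
open import Data.Fin.Subset using (Subset; ∣_∣) renaming (_∈_ to _∈ˢ_)
open import Data.Fin.Subset.Properties using (x∈p⇒∣p-x∣<∣p∣; x∈p∧x≢y⇒x∈p-y)
open import Data.List using (List; []; _∷_; length)
open import Data.List.Relation.Unary.All as All using (All; []; _∷_)
open import Data.List.Relation.Unary.AllPairs using ([]; _∷_)
open import Data.List.Relation.Unary.Any using (here; there)
open import Data.List.Relation.Unary.Unique.Propositional using (Unique)
open import Data.List.Membership.Propositional using (_∈_)
open import Data.Product using (Σ; ∃; ∃₂; _×_; _,_; proj₁; proj₂)
open import Data.Sum using (inj₁; inj₂) renaming (map to ⊎-map)
open import Data.Rational as ℚ using (ℚ; 0ℚ)
import Data.Rational.Properties as ℚ
open import Function using (_∘_)
open import Relation.Binary.PropositionalEquality using (_≢_; ≢-sym; refl; sym; trans; cong; subst)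
open import Relation.Nullary using (Dec; yes; no; contradiction)
open import Relation.Nullary.Decidable using (toWitness)
open import Data.Unit using (tt)

pattern 0F = fzero
pattern 1F = fsuc fzero
pattern 2F = fsuc (fsuc fzero)

module _ {n : ℕ} (E : (Fin n → ℕ) → Set) (E? : ∀ φ → Dec (E φ)) where

  Pr-nonNeg : (D : Dist n) → All (λ p → 0ℚ ℚ.≤ proj₁ p) D → 0ℚ ℚ.≤ Pr E E? D
  Pr-nonNeg [] [] = ℚ.≤-refl
  Pr-nonNeg ((w , φ) ∷ D) (0≤w ∷ 0≤D) with E? φ
  ... | yes _ = ℚ.+-mono-≤ 0≤w (Pr-nonNeg D 0≤D)
  ... | no  _ = Pr-nonNeg D 0≤D

  weight≤Pr : ∀ {w φ} (D : Dist n) → All (λ p → 0ℚ ℚ.≤ proj₁ p) D →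
              (w , φ) ∈ D → E φ → w ℚ.≤ Pr E E? D
  weight≤Pr ((w , φ) ∷ D) (_ ∷ 0≤D) (here refl) e with E? φ
  ... | yes _ = subst (ℚ._≤ w ℚ.+ Pr E E? D) (ℚ.+-identityʳ w)
                  (ℚ.+-monoʳ-≤ w (Pr-nonNeg D 0≤D))
  ... | no ¬e = contradiction e ¬e
  weight≤Pr ((w′ , φ′) ∷ D) (0≤w′ ∷ 0≤D) (there m) e with E? φ′
  ... | yes _ = subst (ℚ._≤ w′ ℚ.+ Pr E E? D) (ℚ.+-identityˡ _)
                  (ℚ.+-mono-≤ 0≤w′ (weight≤Pr D 0≤D m e))
  ... | no  _ = weight≤Pr D 0≤D m e

Column : Set
Column = Fin 3 → ℕ

column : ℕ → ℕ → ℕ → Column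
column a b c 0F = a
column a b c 1F = b
column a b c 2F = c

Onto : List ℕ → Column → Set
Onto L y = (∀ i → y i ∈ L) × (∀ {c} → c ∈ L → ∃ λ i → y i ≡ c)

Apart : Column → Column → Set
Apart x y = ∀ i → x i ≢ y i

NonConstant : Column → Set
NonConstant x = ∃₂ λ i j → x i ≢ x j

TwoOrThreeColours : List ℕ → Set
TwoOrThreeColours L = Unique L × (length L ≡ 2 ⊎ length L ≡ 3)

Extensible : List ℕ → Column → Set
Extensible L x = ∃ λ y → Onto L y × Apart x y

onto-column : ∀ {L a b c} → a ∈ L → b ∈ L → c ∈ L →
              All (λ d → d ≡ a ⊎ d ≡ b ⊎ d ≡ c) L → Onto L (column a b c)
onto-column a∈L b∈L c∈L cover =
  (λ { 0F → a∈L ; 1F → b∈L ; 2F → c∈L }) ,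
  λ d∈L → case (All.lookup cover d∈L)
  where
  case : ∀ {d} → d ≡ _ ⊎ d ≡ _ ⊎ d ≡ _ → ∃ λ i → column _ _ _ i ≡ d
  case (inj₁ e)        = 0F , sym e
  case (inj₂ (inj₁ e)) = 1F , sym e
  case (inj₂ (inj₂ e)) = 2F , sym e

onto-nonConstant : ∀ {L y} → TwoOrThreeColours L → Onto L y → NonConstant y
onto-nonConstant {a ∷ b ∷ _} ((a≢b ∷ _) ∷ _ , _) (_ , cover)
  with cover (here refl) | cover (there (here refl))
... | i , yi≡a | j , yj≡b = i , j , λ yi≡yj → a≢b (trans (sym yi≡a) (trans yi≡yj yj≡b))
onto-nonConstant {[]}     (_ , inj₁ ()) _
onto-nonConstant {[]}     (_ , inj₂ ()) _
onto-nonConstant {_ ∷ []} (_ , inj₁ ()) _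
onto-nonConstant {_ ∷ []} (_ , inj₂ ()) _

nonConstant-avoids : {x : Column} → NonConstant x → ∀ c → ∃ λ i → x i ≢ c
nonConstant-avoids {x} (i , j , xi≢xj) c with x i ℕ.≟ c
... | yes xi≡c = j , λ xj≡c → xi≢xj (trans xi≡c (sym xj≡c))
... | no  xi≢c = i , xi≢c

onto-column-first≢ : ∀ {L} → TwoOrThreeColours L → ∀ d →
                     ∃ λ a → ∃₂ λ p q → a ≢ d × p ≢ q × Onto L (column a p q)
onto-column-first≢ {a ∷ b ∷ []} ((a≢b ∷ []) ∷ _ , _) d with d ℕ.≟ a
... | yes d≡a = b , a , b , (λ b≡d → a≢b (sym (trans b≡d d≡a))) , a≢b ,
  onto-column (there (here refl)) (here refl) (there (here refl))
    (inj₂ (inj₁ refl) ∷ inj₁ refl ∷ [])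
... | no d≢a = a , a , b , ≢-sym d≢a , a≢b ,
  onto-column (here refl) (here refl) (there (here refl))
    (inj₁ refl ∷ inj₂ (inj₂ refl) ∷ [])
onto-column-first≢ {a ∷ b ∷ c ∷ []} ((a≢b ∷ a≢c ∷ []) ∷ (b≢c ∷ []) ∷ _ , _) d with d ℕ.≟ a
... | yes d≡a = b , a , c , (λ b≡d → a≢b (sym (trans b≡d d≡a))) , a≢c ,
  onto-column (there (here refl)) (here refl) (there (there (here refl)))
    (inj₂ (inj₁ refl) ∷ inj₁ refl ∷ inj₂ (inj₂ refl) ∷ [])
... | no d≢a = a , b , c , ≢-sym d≢a , b≢c ,
  onto-column (here refl) (there (here refl)) (there (there (here refl)))
    (inj₁ refl ∷ inj₂ (inj₁ refl) ∷ inj₂ (inj₂ refl) ∷ [])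
onto-column-first≢ {[]}                (_ , inj₁ ()) _
onto-column-first≢ {[]}                (_ , inj₂ ()) _
onto-column-first≢ {_ ∷ []}            (_ , inj₁ ()) _
onto-column-first≢ {_ ∷ []}            (_ , inj₂ ()) _
onto-column-first≢ {_ ∷ _ ∷ _ ∷ _ ∷ _} (_ , inj₁ ()) _
onto-column-first≢ {_ ∷ _ ∷ _ ∷ _ ∷ _} (_ , inj₂ ()) _

pair-apart : ∀ {p q x₁ x₂ : ℕ} → p ≢ q → x₁ ≢ x₂ → (x₁ ≢ p × x₂ ≢ q) ⊎ (x₁ ≢ q × x₂ ≢ p)
pair-apart {p} {q} {x₁} {x₂} p≢q x₁≢x₂ with x₁ ℕ.≟ p | x₂ ℕ.≟ q
... | yes x₁≡p | _        = inj₂ ((λ x₁≡q → p≢q (trans (sym x₁≡p) x₁≡q)) ,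
                                  (λ x₂≡p → x₁≢x₂ (trans x₁≡p (sym x₂≡p))))
... | no  x₁≢p | no x₂≢q  = inj₁ (x₁≢p , x₂≢q)
... | no  _    | yes x₂≡q = inj₂ ((λ x₁≡q → x₁≢x₂ (trans x₁≡q (sym x₂≡q))) ,
                                  (λ x₂≡p → p≢q (trans (sym x₂≡p) x₂≡q)))

swap₁₂ rotate rotate⁻¹ : Fin 3 → Fin 3
swap₁₂ 0F = 0F
swap₁₂ 1F = 2F
swap₁₂ 2F = 1F
rotate 0F = 1F
rotate 1F = 2F
rotate 2F = 0F
rotate⁻¹ 0F = 2F
rotate⁻¹ 1F = 0F
rotate⁻¹ 2F = 1F

swap₁₂-involutive : ∀ i → swap₁₂ (swap₁₂ i) ≡ i
swap₁₂-involutive 0F = refl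
swap₁₂-involutive 1F = refl
swap₁₂-involutive 2F = refl

rotate-inverseˡ : ∀ i → rotate (rotate⁻¹ i) ≡ i
rotate-inverseˡ 0F = refl
rotate-inverseˡ 1F = refl
rotate-inverseˡ 2F = refl

rotate-inverseʳ : ∀ i → rotate⁻¹ (rotate i) ≡ i
rotate-inverseʳ 0F = refl
rotate-inverseʳ 1F = refl
rotate-inverseʳ 2F = refl

module _ (σ τ : Fin 3 → Fin 3) (σ∘τ≗id : ∀ i → σ (τ i) ≡ i) where

  onto-reindex : ∀ {L y} → Onto L y → Onto L (y ∘ σ)
  onto-reindex {y = y} (y∈L , cover) = y∈L ∘ σ , λ c∈L → case (cover c∈L)
    where
    case : ∀ {c} → ∃ (λ i → y i ≡ c) → ∃ λ i → y (σ i) ≡ c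
    case (i , yi≡c) = τ i , trans (cong y (σ∘τ≗id i)) yi≡c

  apart-reindex : ∀ {x y} → Apart (x ∘ σ) y → Apart x (y ∘ τ)
  apart-reindex {x} {y} apart i = subst (λ j → x j ≢ y (τ i)) (σ∘τ≗id i) (apart (τ i))

extensible-reindex : ∀ {L x} (σ τ : Fin 3 → Fin 3) →
                     (∀ i → σ (τ i) ≡ i) → (∀ i → τ (σ i) ≡ i) →
                     Extensible L (x ∘ σ) → Extensible L x
extensible-reindex σ τ σ∘τ≗id τ∘σ≗id (y , onto , apart) =
  y ∘ τ , onto-reindex τ σ τ∘σ≗id onto , apart-reindex σ τ σ∘τ≗id apart

extensible-x₁≢x₂ : ∀ {L x} → TwoOrThreeColours L → x 1F ≢ x 2F → Extensible L x
extensible-x₁≢x₂ {x = x} ok x₁≢x₂ with onto-column-first≢ ok (x 0F)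
... | a , p , q , a≢x₀ , p≢q , onto with pair-apart p≢q x₁≢x₂
...   | inj₁ (x₁≢p , x₂≢q) = column a p q , onto ,
        λ { 0F → ≢-sym a≢x₀ ; 1F → x₁≢p ; 2F → x₂≢q }
...   | inj₂ (x₁≢q , x₂≢p) = column a p q ∘ swap₁₂ ,
        onto-reindex swap₁₂ swap₁₂ swap₁₂-involutive onto ,
        λ { 0F → ≢-sym a≢x₀ ; 1F → x₁≢q ; 2F → x₂≢p }

extensible : ∀ {L x} → TwoOrThreeColours L → NonConstant x → Extensible L x
extensible {x = x} ok (i , j , xi≢xj) with x 1F ℕ.≟ x 2F | x 2F ℕ.≟ x 0F
... | no x₁≢x₂ | _        = extensible-x₁≢x₂ ok x₁≢x₂
... | yes _    | no x₂≢x₀ = extensible-reindex rotate rotate⁻¹ rotate-inverseˡ rotate-inverseʳ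
                              (extensible-x₁≢x₂ ok x₂≢x₀)
... | yes x₁≡x₂ | yes x₂≡x₀ = contradiction (trans (≡x₀ i) (sym (≡x₀ j))) xi≢xj
  where
  ≡x₀ : ∀ k → x k ≡ x 0F
  ≡x₀ 0F = refl
  ≡x₀ 1F = trans x₁≡x₂ x₂≡x₀
  ≡x₀ 2F = x₂≡x₀

module ColumnSequence (L : ℕ → List ℕ) (ok : ∀ i → TwoOrThreeColours (L i)) where

  columns : ∀ i → Σ Column (Onto (L i))
  nextColumn : ∀ i → Extensible (L (suc i)) (proj₁ (columns i))

  columns zero with onto-column-first≢ (ok zero) 0
  ... | a , p , q , _ , _ , onto = column a p q , onto
  columns (suc i) = proj₁ (nextColumn i) , proj₁ (proj₂ (nextColumn i))

  nextColumn i = extensible (ok (suc i)) (onto-nonConstant (ok i) (proj₂ (columns i)))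

  columns-apart : ∀ i → Apart (proj₁ (columns i)) (proj₁ (columns (suc i)))
  columns-apart i = proj₂ (proj₂ (nextColumn i))

extendFin : {A : Set} {n : ℕ} → A → (Fin n → A) → ℕ → A
extendFin {n = zero}  d g _       = d
extendFin {n = suc _} d g zero    = g fzero
extendFin {n = suc _} d g (suc i) = extendFin d (g ∘ fsuc) i

extendFin-toℕ : {A : Set} {n : ℕ} (d : A) (g : Fin n → A) (v : Fin n) →
                extendFin d g (toℕ v) ≡ g v
extendFin-toℕ d g fzero    = refl
extendFin-toℕ d g (fsuc v) = extendFin-toℕ d (g ∘ fsuc) v

extendFin-preserves : {A : Set} {n : ℕ} (P : A → Set) {d : A} {g : Fin n → A} →
                      P d → (∀ v → P (g v)) → ∀ i → P (extendFin d g i)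
extendFin-preserves {n = zero}  P Pd Pg _       = Pd
extendFin-preserves {n = suc _} P Pd Pg zero    = Pg fzero
extendFin-preserves {n = suc _} P Pd Pg (suc i) = extendFin-preserves P Pd (Pg ∘ fsuc) i

∣p∣≤1∧x∈p∧y∈p⇒x≡y : ∀ {n} {p : Subset n} {x y} → ∣ p ∣ ℕ.≤ 1 → x ∈ˢ p → y ∈ˢ p → x ≡ y
∣p∣≤1∧x∈p∧y∈p⇒x≡y {x = x} {y} ∣p∣≤1 x∈p y∈p with x Fin.≟ y
... | yes x≡y = x≡y
-- otherwise ∣ p - y - x ∣ + 2 ≤ ∣ p ∣ ≤ 1
... | no  x≢y with ℕ.≤-trans (s≤s (x∈p⇒∣p-x∣<∣p∣ (x∈p∧x≢y⇒x∈p-y x∈p x≢y)))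
                             (ℕ.≤-trans (x∈p⇒∣p-x∣<∣p∣ y∈p) ∣p∣≤1)
...   | s≤s ()

module PathColouring {n : ℕ} (L : ListAssignment n) (ok : ∀ v → TwoOrThreeColours (L v)) where

  -- View the path as an initial segment of an infinite path whose remaining lists are [0, 1].
  open ColumnSequence (extendFin (0 ∷ 1 ∷ []) L)
                      (extendFin-preserves TwoOrThreeColours (((λ ()) ∷ []) ∷ [] ∷ [] , inj₁ refl) ok)

  columnAt : Fin n → Column
  columnAt v = proj₁ (columns (toℕ v))

  columnAt-onto : ∀ v → Onto (L v) (columnAt v)
  columnAt-onto v =
    subst (λ K → Onto K (columnAt v)) (extendFin-toℕ _ L v) (proj₂ (columns (toℕ v)))

  columnAt-apart : ∀ u v → PathGraph n u v → Apart (columnAt u) (columnAt v)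
  columnAt-apart u v (inj₁ v≡u+1) i =
    subst (λ k → columnAt u i ≢ proj₁ (columns k) i) (sym v≡u+1) (columns-apart (toℕ u) i)
  columnAt-apart u v (inj₂ u≡v+1) i =
    subst (λ k → proj₁ (columns k) i ≢ columnAt v i) (sym u≡v+1) (≢-sym (columns-apart (toℕ v) i))

  colouring : Fin 3 → Fin n → ℕ
  colouring i v = columnAt v i

  colouring-isLColoring : ∀ i → IsLColoring (PathGraph n) L (colouring i)
  colouring-isLColoring i =
    (λ v → proj₁ (columnAt-onto v) i) , λ u v uv → columnAt-apart u v uv i

⅓ : ℚ
⅓ = + 1 / 3

module Uniform {n : ℕ} (φ : Fin 3 → Fin n → ℕ) where

  uniform : Dist n
  uniform = (⅓ , φ 0F) ∷ (⅓ , φ 1F) ∷ (⅓ , φ 2F) ∷ []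

  0≤⅓ : 0ℚ ℚ.≤ ⅓
  0≤⅓ = toWitness {a? = 0ℚ ℚ.≤? ⅓} tt

  uniform-isLColoringDist : ∀ {G L} → (∀ i → IsLColoring G L (φ i)) →
                            IsLColoringDist G L uniform
  uniform-isLColoringDist col = ((0≤⅓ , col 0F) ∷ (0≤⅓ , col 1F) ∷ (0≤⅓ , col 2F) ∷ []) , refl

  ⅓≤Pr-uniform : (E : (Fin n → ℕ) → Set) (E? : ∀ φ → Dec (E φ)) →
                 ∃ (λ i → E (φ i)) → ⅓ ℚ.≤ Pr E E? uniform
  ⅓≤Pr-uniform E E? (i , e) = weight≤Pr E E? uniform (0≤⅓ ∷ 0≤⅓ ∷ 0≤⅓ ∷ []) (∈-uniform i) e
    where
    ∈-uniform : ∀ i → (⅓ , φ i) ∈ uniform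
    ∈-uniform 0F = here refl
    ∈-uniform 1F = there (here refl)
    ∈-uniform 2F = there (there (here refl))

lemma3p9 : (n : ℕ) (f : Fin n → ℕ) → (∀ v → f v ≡ 2 ⊎ f v ≡ 3) →
    Reductive (PathGraph n) f 3 (+ 1 / 3)
lemma3p9 n f f∈23 L isF =
  uniform , uniform-isLColoringDist colouring-isLColoring , fix , forb
  where
  ok : ∀ v → TwoOrThreeColours (L v)
  ok v = proj₁ (isF v) , ⊎-map (trans (proj₂ (isF v))) (trans (proj₂ (isF v))) (f∈23 v)

  open PathColouring L ok
  open Uniform colouring

  fix : ∀ v c → c ∈ L v → ⅓ ℚ.≤ Pr (HasColor v c) (hasColor? v c) uniform
  fix v c c∈L = ⅓≤Pr-uniform (HasColor v c) (hasColor? v c) (proj₂ (columnAt-onto v) c∈L)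

  forb : ∀ U → ∣ U ∣ ℕ.≤ 1 → ∀ c → (∃ λ u → u ∈ˢ U × c ∈ L u) →
         ⅓ ℚ.≤ Pr (Avoids U c) (avoids? U c) uniform
  forb U ∣U∣≤1 c (u , u∈U , _)
    with nonConstant-avoids (onto-nonConstant (ok u) (columnAt-onto u)) c
  ... | i , φᵢu≢c = ⅓≤Pr-uniform (Avoids U c) (avoids? U c) (i , λ w w∈U →
                      subst (λ x → colouring i x ≢ c) (∣p∣≤1∧x∈p∧y∈p⇒x≡y ∣U∣≤1 u∈U w∈U) φᵢu≢c)
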